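{- Let $w\ge2$ be even and $E$ a weighted Dedekind symbol of weight $w$. (1) For fixed positive integers $a,d$, the function $\tilde E_{a,d}(h,k)=\sum_{b \bmod d}E(dh,ak+bh)$ on $\mathbb Z^+\times\mathbb Z$ is a weighted Dedekind symbol of weight $w$. (2) For every positive integer $n$, $T_nE$ is a weighted Dedekind symbol of weight $w$, where $(T_nE)(h,k)=\sum_{ad=n,\ d>0}\sum_{b\bmod d}E(dh,ak+bh)$.
   Context: A weighted Dedekind symbol of weight $w$ is a function $E:\mathbb Z^+\times\mathbb Z\to\mathbb C$ with $E(h,k)=E(h,k+h)$ for all $(h,k)$ and $E(ch,ck)=c^wE(h,k)$ for all $(h,k)$ and $c\in\mathbb Z^+$. Sums over $b \bmod d$ run over a complete residue system modulo $d$ (well defined by periodicity of $E$); $a,d$ in $T_n$ run over positive integers with $ad=n$. -}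

module Defs where


open import Algebra.Bundles using (CommutativeRing; Semiring)
open import Data.Nat as ℕ using (ℕ; zero; suc; NonZero)
open import Data.Nat.Properties using (m*n≢0)
open import Data.Nat.Divisibility using (_∣?_)
open import Data.Integer as ℤ using (ℤ; +_)
open import Data.Product using (_×_)
open import Relation.Nullary using (yes; no)

module _ {c ℓ} (R : CommutativeRing c ℓ) where
  open CommutativeRing R
  open import Algebra.Definitions.RawSemiring (Semiring.rawSemiring semiring) using (_^_) renaming (_×_ to _·ℕ_)

  -- Functions Z^+ x Z -> R ; the positive first argument is a natural
  -- number h together with an (irrelevant, definitionally unique) NonZero proof.
  Sym : Set c
  Sym = (h : ℕ) → .{{NonZero h}} → ℤ → Carrier

  IsWeightedDedekind : ℕ → Sym → Set ℓ
  IsWeightedDedekind w E =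
    (∀ (h : ℕ) .{{_ : NonZero h}} (k : ℤ) → E h k ≈ E h (k ℤ.+ + h))
    × (∀ (c h : ℕ) .{{_ : NonZero c}} .{{_ : NonZero h}} (k : ℤ) →
         E (c ℕ.* h) {{m*n≢0 c h}} (+ c ℤ.* k) ≈ ((c ·ℕ 1#) ^ w) * E h k)

  -- Σ_{b = 0}^{n-1} f b  (a complete residue system modulo n)
  sumBelow : ℕ → (ℕ → Carrier) → Carrier
  sumBelow zero    f = 0#
  sumBelow (suc n) f = sumBelow n f + f n

  tildeE : (a d : ℕ) → .{{NonZero d}} → Sym → Sym
  tildeE a d E h k =
    sumBelow d (λ b → E (d ℕ.* h) {{m*n≢0 d h}} (+ a ℤ.* k ℤ.+ + b ℤ.* + h))

  divSumUpTo : (m n : ℕ) → ((a d : ℕ) → .{{NonZero d}} → Carrier) → Carrier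
  divSumUpTo zero    n f = 0#
  divSumUpTo (suc m) n f with suc m ∣? n
  ... | yes _ = divSumUpTo m n f + f (n ℕ./ suc m) (suc m)
  ... | no  _ = divSumUpTo m n f

  divisorSum : (n : ℕ) → ((a d : ℕ) → .{{NonZero d}} → Carrier) → Carrier
  divisorSum n f = divSumUpTo n n f

  T : (n : ℕ) → Sym → Sym
  T n E h k = divisorSum n (λ a d → tildeE a d E h k)

{-# OPTIONS --safe #-}
-- Ẽ_{a,d}(h, k + h) is the same sum with b shifted to b + a, and b ↦ E(dh, ak + bh) is
-- d-periodic by the periodicity of E, so the shift only permutes the residues mod d.
-- Scaling (h, k) by c scales every argument of E in Ẽ_{a,d} by c, which pulls out c^w.
-- T_n E is a finite sum of the Ẽ_{a,d}, and both defining properties are preserved by sums.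
module Submission where

open import Defs
open import Algebra.Bundles using (CommutativeRing; Semiring)
open import Data.Nat as ℕ using (ℕ; zero; suc; NonZero; _≤_)
open import Data.Nat.Properties using (m*n≢0)
import Data.Nat.Properties as ℕ
open import Algebra.Properties.CommutativeSemigroup ℕ.*-commutativeSemigroup using (x∙yz≈y∙xz)
open import Data.Nat.Divisibility using (_∣?_)
open import Data.Integer as ℤ using (ℤ; +_)
import Data.Integer.Properties as ℤ
open import Data.Integer.Tactic.RingSolver using (solve-∀)
open import Data.Product using (_×_; ∃; _,_; proj₁; proj₂)
open import Relation.Binary.PropositionalEquality as ≡ using (_≡_)
open import Relation.Nullary using (yes; no)

module _ where
  open import Data.Integer.Base using (_+_; _*_)
  open ≡.≡-Reasoning

  argument-shift : ∀ a b h k → + a * (k + + h) + + b * + h ≡ + a * k + + (a ℕ.+ b) * + h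
  argument-shift a b h k = begin
    + a * (k + + h) + + b * + h   ≡⟨ expand (+ a) (+ b) (+ h) k ⟩
    + a * k + (+ a + + b) * + h   ≡⟨ ≡.cong (λ x → + a * k + x * + h) (ℤ.pos-+ a b) ⟨
    + a * k + + (a ℕ.+ b) * + h   ∎
    where
    expand : ∀ (a b h k : ℤ) → a * (k + h) + b * h ≡ a * k + (a + b) * h
    expand = solve-∀

  argument-period : ∀ a b d h k → + a * k + + b * + h + + (d ℕ.* h) ≡ + a * k + + (b ℕ.+ d) * + h
  argument-period a b d h k = begin
    + a * k + + b * + h + + (d ℕ.* h)   ≡⟨ ≡.cong (λ x → + a * k + + b * + h + x) (ℤ.pos-* d h) ⟩
    + a * k + + b * + h + + d * + h     ≡⟨ collect (+ a * k) (+ b) (+ d) (+ h) ⟩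
    + a * k + (+ b + + d) * + h         ≡⟨ ≡.cong (λ x → + a * k + x * + h) (ℤ.pos-+ b d) ⟨
    + a * k + + (b ℕ.+ d) * + h         ∎
    where
    collect : ∀ (x b d h : ℤ) → x + b * h + d * h ≡ x + (b + d) * h
    collect = solve-∀

  argument-scale : ∀ a b c h k → + a * (+ c * k) + + b * + (c ℕ.* h) ≡ + c * (+ a * k + + b * + h)
  argument-scale a b c h k = begin
    + a * (+ c * k) + + b * + (c ℕ.* h)   ≡⟨ ≡.cong (λ x → + a * (+ c * k) + + b * x) (ℤ.pos-* c h) ⟩
    + a * (+ c * k) + + b * (+ c * + h)   ≡⟨ factor (+ a) (+ b) (+ c) (+ h) k ⟩
    + c * (+ a * k + + b * + h)           ∎
    where
    factor : ∀ (a b c h k : ℤ) → a * (c * k) + b * (c * h) ≡ c * (a * k + b * h)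
    factor = solve-∀

module _ {c ℓ} (R : CommutativeRing c ℓ) where
  open CommutativeRing R
  open import Algebra.Definitions.RawSemiring (Semiring.rawSemiring semiring)
    using (_^_) renaming (_×_ to _·ℕ_)
  open import Algebra.Properties.Group +-group using (∙-cancelʳ)
  open import Relation.Binary.Reasoning.Setoid setoid

  sumBelow-cong : ∀ n {f g : ℕ → Carrier} → (∀ b → f b ≈ g b) → sumBelow R n f ≈ sumBelow R n g
  sumBelow-cong zero    f≈g = refl
  sumBelow-cong (suc n) f≈g = +-cong (sumBelow-cong n f≈g) (f≈g n)

  sumBelow-distribˡ : ∀ n x (f : ℕ → Carrier) →
                      sumBelow R n (λ b → x * f b) ≈ x * sumBelow R n f
  sumBelow-distribˡ zero    x f = sym (zeroʳ x)
  sumBelow-distribˡ (suc n) x f = trans (+-cong (sumBelow-distribˡ n x f) refl) (sym (distribˡ x _ _))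

  sumBelow-suc : ∀ n (f : ℕ → Carrier) →
                 sumBelow R (suc n) f ≈ f 0 + sumBelow R n (λ b → f (suc b))
  sumBelow-suc zero    f = +-comm 0# (f 0)
  sumBelow-suc (suc n) f = trans (+-cong (sumBelow-suc n f) refl) (+-assoc _ _ _)

  sumBelow-rotate₁ : ∀ d (f : ℕ → Carrier) → f d ≈ f 0 →
                     sumBelow R d (λ b → f (suc b)) ≈ sumBelow R d f
  sumBelow-rotate₁ d f fd≈f0 = sym (∙-cancelʳ (f d) _ _ (begin
    sumBelow R d f + f d                       ≈⟨ sumBelow-suc d f ⟩
    f 0 + sumBelow R d (λ b → f (suc b))       ≈⟨ +-comm _ _ ⟩
    sumBelow R d (λ b → f (suc b)) + f 0       ≈⟨ +-cong refl (sym fd≈f0) ⟩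
    sumBelow R d (λ b → f (suc b)) + f d       ∎))

  sumBelow-rotate : ∀ a d (f : ℕ → Carrier) → (∀ b → f (b ℕ.+ d) ≈ f b) →
                    sumBelow R d (λ b → f (a ℕ.+ b)) ≈ sumBelow R d f
  sumBelow-rotate zero    d f periodic = refl
  sumBelow-rotate (suc a) d f periodic = begin
    sumBelow R d (λ b → f (suc a ℕ.+ b))  ≈⟨ sumBelow-rotate a d (λ b → f (suc b)) (λ b → periodic (suc b)) ⟩
    sumBelow R d (λ b → f (suc b))        ≈⟨ sumBelow-rotate₁ d f (periodic 0) ⟩
    sumBelow R d f                        ∎

  DivisorFamily : Set c
  DivisorFamily = (a d : ℕ) → .{{NonZero d}} → Carrier

  divSumUpTo-cong : ∀ m n {f g : DivisorFamily} → (∀ a d .{{_ : NonZero d}} → f a d ≈ g a d) →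
                    divSumUpTo R m n f ≈ divSumUpTo R m n g
  divSumUpTo-cong zero    n f≈g = refl
  divSumUpTo-cong (suc m) n f≈g with suc m ∣? n
  ... | yes _ = +-cong (divSumUpTo-cong m n f≈g) (f≈g _ _)
  ... | no  _ = divSumUpTo-cong m n f≈g

  divSumUpTo-distribˡ : ∀ m n x (f : DivisorFamily) →
                        divSumUpTo R m n (λ a d → x * f a d) ≈ x * divSumUpTo R m n f
  divSumUpTo-distribˡ zero    n x f = sym (zeroʳ x)
  divSumUpTo-distribˡ (suc m) n x f with suc m ∣? n
  ... | yes _ = trans (+-cong (divSumUpTo-distribˡ m n x f) refl) (sym (distribˡ x _ _))
  ... | no  _ = divSumUpTo-distribˡ m n x f

  Sym-cong : ∀ (E : Sym R) {h h'} .{{_ : NonZero h}} .{{_ : NonZero h'}} {k k'} →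
             h ≡ h' → k ≡ k' → E h k ≈ E h' k'
  Sym-cong E ≡.refl ≡.refl = refl

  module _ (w : ℕ) {E : Sym R} (isWD : IsWeightedDedekind R w E) where
    private
      periodic = proj₁ isWD
      homogeneous = proj₂ isWD

    tildeE-periodic : ∀ a d .{{_ : NonZero d}} (h : ℕ) .{{_ : NonZero h}} (k : ℤ) →
                      tildeE R a d E h k ≈ tildeE R a d E h (k ℤ.+ + h)
    tildeE-periodic a d h k = sym (begin
      sumBelow R d (λ b → E dh (+ a ℤ.* (k ℤ.+ + h) ℤ.+ + b ℤ.* + h))
        ≈⟨ sumBelow-cong d (λ b → Sym-cong E ≡.refl (argument-shift a b h k)) ⟩
      sumBelow R d (λ b → term (a ℕ.+ b))  ≈⟨ sumBelow-rotate a d term term-periodic ⟩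
      sumBelow R d term                   ∎)
      where
      dh : ℕ
      dh = d ℕ.* h
      instance
        dh≢0 : NonZero dh
        dh≢0 = m*n≢0 d h

      term : ℕ → Carrier
      term b = E dh (+ a ℤ.* k ℤ.+ + b ℤ.* + h)

      term-periodic : ∀ b → term (b ℕ.+ d) ≈ term b
      term-periodic b = sym (trans (periodic dh _) (Sym-cong E ≡.refl (argument-period a b d h k)))

    tildeE-homogeneous : ∀ a d .{{_ : NonZero d}} (c h : ℕ) .{{_ : NonZero c}} .{{_ : NonZero h}} (k : ℤ) →
      tildeE R a d E (c ℕ.* h) {{m*n≢0 c h}} (+ c ℤ.* k) ≈ ((c ·ℕ 1#) ^ w) * tildeE R a d E h k
    tildeE-homogeneous a d c h k = begin
      tildeE R a d E (c ℕ.* h) (+ c ℤ.* k)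
        ≈⟨ sumBelow-cong d (λ b → trans (Sym-cong E (x∙yz≈y∙xz d c h) (argument-scale a b c h k))
                                         (homogeneous c (d ℕ.* h) _)) ⟩
      sumBelow R d (λ b → (c ·ℕ 1#) ^ w * term b)  ≈⟨ sumBelow-distribˡ d _ term ⟩
      (c ·ℕ 1#) ^ w * tildeE R a d E h k           ∎
      where
      instance
        ch≢0 : NonZero (c ℕ.* h)
        ch≢0 = m*n≢0 c h
        dh≢0 : NonZero (d ℕ.* h)
        dh≢0 = m*n≢0 d h
        d[ch]≢0 : NonZero (d ℕ.* (c ℕ.* h))
        d[ch]≢0 = m*n≢0 d (c ℕ.* h)
        c[dh]≢0 : NonZero (c ℕ.* (d ℕ.* h))
        c[dh]≢0 = m*n≢0 c (d ℕ.* h)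

      term : ℕ → Carrier
      term b = E (d ℕ.* h) (+ a ℤ.* k ℤ.+ + b ℤ.* + h)

    tildeE-isWeightedDedekind : ∀ a d .{{_ : NonZero d}} → IsWeightedDedekind R w (tildeE R a d E)
    tildeE-isWeightedDedekind a d = tildeE-periodic a d , tildeE-homogeneous a d

  divSumUpTo-isWeightedDedekind : ∀ w m n (F : (a d : ℕ) → .{{NonZero d}} → Sym R) →
    (∀ a d .{{_ : NonZero d}} → IsWeightedDedekind R w (F a d)) →
    IsWeightedDedekind R w (λ h k → divSumUpTo R m n (λ a d → F a d h k))
  divSumUpTo-isWeightedDedekind w m n F isWD =
      (λ h k → divSumUpTo-cong m n (λ a d → proj₁ (isWD a d) h k))
    , (λ c h k → trans (divSumUpTo-cong m n (λ a d → proj₂ (isWD a d) c h k))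
                       (divSumUpTo-distribˡ m n _ _))

  T-isWeightedDedekind : ∀ w {E : Sym R} → IsWeightedDedekind R w E →
                         ∀ n → IsWeightedDedekind R w (T R n E)
  T-isWeightedDedekind w {E} isWD n =
    divSumUpTo-isWeightedDedekind w n n (λ a d → tildeE R a d E) (λ a d → tildeE-isWeightedDedekind w isWD a d)

open import Data.Nat using (_*_)

lemma3p1 : ∀ {c ℓ} (R : CommutativeRing c ℓ) (w : ℕ) → 2 ≤ w → (∃ λ m → w ≡ 2 * m) →
    (E : Sym R) → IsWeightedDedekind R w E →
    ((a d : ℕ) → .{{_ : NonZero a}} → .{{_ : NonZero d}} → IsWeightedDedekind R w (tildeE R a d E))
    × ((n : ℕ) → .{{_ : NonZero n}} → IsWeightedDedekind R w (T R n E))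
lemma3p1 R w _ _ E isWD =
    (λ a d → tildeE-isWeightedDedekind R w isWD a d)
  , (λ n → T-isWeightedDedekind R w isWD n)
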